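{- Let $e$ be a regular expression over a finite alphabet $\Sigma$, let $\pi$ be a heap and $p$ an address with $\pi,p\models e$, with continuation function $\mathrm{cont}$ satisfying $\pi\models\mathrm{cont}$ (root $p$). Then for every string $w\in\Sigma^*$, there is a run of the PW$\pi$ machine \[ \langle p\,;\,w\rangle\to^{*}\langle\mathrm{null}\,;\,\epsilon_{\mathrm{str}}\rangle \] if and only if there is a finite run of the generic lockstep machine \[ \langle \{p\}\,;\,w\rangle \Rightarrow \cdots \Rightarrow \langle S\,;\,\epsilon_{\mathrm{str}}\rangle \] for some set of addresses $S$ with $\mathrm{null}\in S$.
   Context: Regular expressions over $\Sigma$: $e ::= \varepsilon \mid a \mid e^{*} \mid e_1e_2 \mid e_1\mid e_2$ ($a\in\Sigma$); $\varepsilon$ is a constant and $\epsilon_{\mathrm{str}}$ denotes the empty string. Heaps: a heap $\pi$ is a finite partial function from addresses to nodes; there is a distinguished address $\mathrm{null}$ not in its domain. A node is one of $a$ ($a\in\Sigma$), $\varepsilon$, $(p_1\mid p_2)$, $(p_1\bullet p_2)$, $(p_1)^{*}$ for addresses $p_1,p_2$. For partial functions with disjoint domains, $f_1\otimes f_2=f_1\cup f_2$. The relation $\pi,p\models e$ is defined by induction on $e$: $\pi,p\models a$ iff $\pi(p)=a$; $\pi,p\models\varepsilon$ iff $\pi(p)=\varepsilon$ (in these cases $\pi$ consists of the single cell at $p$); $\pi,p\models(e_1\mid e_2)$ iff $\pi=\pi_0\otimes\pi_1\otimes\pi_2$, $\pi_0(p)=(p_1\mid p_2)$, $\pi_1,p_1\models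 e_1$, $\pi_2,p_2\models e_2$; $\pi,p\models(e_1e_2)$ iff $\pi=\pi_0\otimes\pi_1\otimes\pi_2$, $\pi_0(p)=(p_1\bullet p_2)$, $\pi_1,p_1\models e_1$, $\pi_2,p_2\models e_2$; $\pi,p\models e_1^{*}$ iff $\pi=\pi_0\otimes\pi_1$, $\pi_0(p)=(p_1)^{*}$, $\pi_1,p_1\models e_1$. Continuation function: $\mathrm{cont}:\mathrm{dom}(\pi)\to\mathrm{dom}(\pi)\cup\{\mathrm{null}\}$ with $\pi\models\mathrm{cont}$ meaning: if $\pi(q)=(q_1\mid q_2)$ then $\mathrm{cont}(q_1)=\mathrm{cont}(q_2)=\mathrm{cont}(q)$; if $\pi(q)=(q_1\bullet q_2)$ then $\mathrm{cont}(q_1)=q_2$, $\mathrm{cont}(q_2)=\mathrm{cont}(q)$; if $\pi(q)=(q_1)^{*}$ then $\mathrm{cont}(q_1)=q$; and $\mathrm{cont}$ of the root is $\mathrm{null}$. Pointer steps relative to $\pi$: $q\to q_1$ and $q\to q_2$ if $\pi(q)=q_1\mid q_2$; $q\to q_1$ if $\pi(q)=q_1\bullet q_2$; $q\to q_1$ and $q\to\mathrm{cont}(q)$ if $\pi(q)=(q_1)^{*}$; $q\to\mathrm{cont}(q)$ if $\pi(q)=\varepsilon$; $q\xrightarrow{a}\mathrm{cont}(q)$ if $\pi(q)=a$. ($\mathrm{null}$ has no steps.) The PW$\pi$ machine has configurations $\langle q;w\rangle$ and transitions $\langle q;a\,w\rangle\to\langle q';w\rangle$ if $q\xrightarrow{a}q'$,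 and $\langle q;w\rangle\to\langle q';w\rangle$ if $q\to q'$; $\to^*$ is zero or more transitions. Evolution: for $S\subseteq\mathrm{dom}(\pi)\cup\{\mathrm{null}\}$, $\mathrm{evolve}(S)=\{q\in\mathrm{dom}(\pi)\cup\{\mathrm{null}\}\mid \exists p'\in S.\ p'\to^{*}q \text{ and } (q=\mathrm{null} \text{ or } \exists a.\ \pi(q)=a)\}$, where $\to^*$ is the reflexive–transitive closure of the unlabeled pointer step. Lockstep transitions on sets: $S\Rightarrow S'$ if $S'=\mathrm{evolve}(S)$; $S\xRightarrow{a}S'$ if $S'=\{q\in\mathrm{dom}(\pi)\cup\{\mathrm{null}\}\mid\exists p'\in S.\ p'\xrightarrow{a}q\}$. The generic lockstep machine has configurations $\langle S;w\rangle$ and transitions $\langle S;a\,w\rangle\Rightarrow\langle S';w\rangle$ if $S\xRightarrow{a}S'$, and $\langle S;w\rangle\Rightarrow\langle S';w\rangle$ if $S\Rightarrow S'$. -}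

module Defs where

open import Level using (0ℓ)
open import Data.Nat using (ℕ; _≡ᵇ_)
open import Data.Fin using (Fin)
open import Data.Bool using (if_then_else_)
open import Data.Maybe using (Maybe; just; nothing)
open import Data.List using (List; []; _∷_)
open import Data.Product using (Σ; ∃; _×_; _,_)
open import Data.Sum using (_⊎_)
open import Function.Bundles using (_↔_; _⇔_)
open import Relation.Binary.PropositionalEquality using (_≡_)
open import Relation.Binary.Construct.Closure.ReflexiveTransitive using (Star)
open import Relation.Unary using (Pred)

Finite : Set → Set
Finite A = Σ ℕ λ n → A ↔ Fin n

data Regex (A : Set) : Set where
  ε    : Regex A
  chr  : A → Regex A
  _*   : Regex A → Regex A
  _·_  : Regex A → Regex A → Regex A
  _∣_  : Regex A → Regex A → Regex A

Addr : Set
Addr = ℕ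

data Loc : Set where
  null : Loc
  ptr  : Addr → Loc

data Node (A : Set) : Set where
  sym  : A → Node A
  eps  : Node A
  alt  : Addr → Addr → Node A
  cat  : Addr → Addr → Node A
  star : Addr → Node A

-- A heap is a partial function from addresses to nodes
-- (null is not an address, hence never in the domain).
Heap : Set → Set
Heap A = Addr → Maybe (Node A)

Single : {A : Set} → Heap A → Addr → Node A → Set
Single π p n = ∀ q → π q ≡ (if q ≡ᵇ p then just n else nothing)

-- π = π₀ ⊗ π₁ ⊗ π₂ (union of pairwise disjoint partial functions).
Union3 : {A : Set} → Heap A → Heap A → Heap A → Heap A → Set
Union3 π π₀ π₁ π₂ = ∀ q →
    (π q ≡ π₀ q × π₁ q ≡ nothing × π₂ q ≡ nothing)
  ⊎ (π₀ q ≡ nothing × π q ≡ π₁ q × π₂ q ≡ nothing)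
  ⊎ (π₀ q ≡ nothing × π₁ q ≡ nothing × π q ≡ π₂ q)

Union2 : {A : Set} → Heap A → Heap A → Heap A → Set
Union2 π π₀ π₁ = ∀ q →
    (π q ≡ π₀ q × π₁ q ≡ nothing)
  ⊎ (π₀ q ≡ nothing × π q ≡ π₁ q)

data _,_⊨_ {A : Set} : Heap A → Addr → Regex A → Set where
  ⊨chr : ∀ {π p a} → Single π p (sym a) → π , p ⊨ chr a
  ⊨ε   : ∀ {π p} → Single π p eps → π , p ⊨ ε
  ⊨∣   : ∀ {π π₀ π₁ π₂ p p₁ p₂ e₁ e₂} →
         Union3 π π₀ π₁ π₂ → Single π₀ p (alt p₁ p₂) →
         π₁ , p₁ ⊨ e₁ → π₂ , p₂ ⊨ e₂ → π , p ⊨ (e₁ ∣ e₂)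
  ⊨·   : ∀ {π π₀ π₁ π₂ p p₁ p₂ e₁ e₂} →
         Union3 π π₀ π₁ π₂ → Single π₀ p (cat p₁ p₂) →
         π₁ , p₁ ⊨ e₁ → π₂ , p₂ ⊨ e₂ → π , p ⊨ (e₁ · e₂)
  ⊨*   : ∀ {π π₀ π₁ p p₁ e₁} →
         Union2 π π₀ π₁ → Single π₀ p (star p₁) →
         π₁ , p₁ ⊨ e₁ → π , p ⊨ (e₁ *)

-- Continuation functions (total on addresses; only values on dom(π) matter).
Cont : Set
Cont = Addr → Loc

record ContOK {A : Set} (π : Heap A) (root : Addr) (cont : Cont) : Set where
  field
    cont-alt  : ∀ q q₁ q₂ → π q ≡ just (alt q₁ q₂) → cont q₁ ≡ cont q × cont q₂ ≡ cont q
    cont-cat  : ∀ q q₁ q₂ → π q ≡ just (cat q₁ q₂) → cont q₁ ≡ ptr q₂ × cont q₂ ≡ cont q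
    cont-star : ∀ q q₁ → π q ≡ just (star q₁) → cont q₁ ≡ ptr q
    cont-root : cont root ≡ null

module Machines {A : Set} (π : Heap A) (cont : Cont) where

  data _⟶_ : Loc → Loc → Set where
    alt₁  : ∀ {q q₁ q₂} → π q ≡ just (alt q₁ q₂) → ptr q ⟶ ptr q₁
    alt₂  : ∀ {q q₁ q₂} → π q ≡ just (alt q₁ q₂) → ptr q ⟶ ptr q₂
    cat₁  : ∀ {q q₁ q₂} → π q ≡ just (cat q₁ q₂) → ptr q ⟶ ptr q₁
    star₁ : ∀ {q q₁} → π q ≡ just (star q₁) → ptr q ⟶ ptr q₁
    star₂ : ∀ {q q₁} → π q ≡ just (star q₁) → ptr q ⟶ cont q
    eps₁  : ∀ {q} → π q ≡ just eps → ptr q ⟶ cont q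

  data _─_⟶_ : Loc → A → Loc → Set where
    sym₁ : ∀ {q a} → π q ≡ just (sym a) → ptr q ─ a ⟶ cont q

  _⟶*_ : Loc → Loc → Set
  _⟶*_ = Star _⟶_

  PWConf : Set
  PWConf = Loc × List A

  data _↦_ : PWConf → PWConf → Set where
    pw-sym : ∀ {q q' a w} → q ─ a ⟶ q' → (q , a ∷ w) ↦ (q' , w)
    pw-eps : ∀ {q q' w} → q ⟶ q' → (q , w) ↦ (q' , w)

  _↦*_ : PWConf → PWConf → Set
  _↦*_ = Star _↦_

  LocSet : Set₁
  LocSet = Pred Loc 0ℓ

  ｛_｝ : Loc → LocSet
  ｛ q ｝ = λ q' → q' ≡ q

  _≐_ : LocSet → LocSet → Set
  S ≐ T = ∀ q → S q ⇔ T q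

  IsFinal : Loc → Set
  IsFinal q = q ≡ null ⊎ ∃ λ a → Σ Addr λ n → q ≡ ptr n × π n ≡ just (sym a)

  evolve : LocSet → LocSet
  evolve S q = ∃ λ p' → S p' × p' ⟶* q × IsFinal q

  stepSet : A → LocSet → LocSet
  stepSet a S q = ∃ λ p' → S p' × p' ─ a ⟶ q

  LConf : Set₁
  LConf = LocSet × List A

  data _⇒_ : LConf → LConf → Set₁ where
    ls-sym : ∀ {S S' a w} → S' ≐ stepSet a S → (S , a ∷ w) ⇒ (S' , w)
    ls-evo : ∀ {S S' w} → S' ≐ evolve S → (S , w) ⇒ (S' , w)

  _⇒*_ : LConf → LConf → Set₁
  _⇒*_ = Star _⇒_

module Submission where

-- An accepting PWπ run from q either
-- follows unlabelled steps to null on empty input, or follows unlabelled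
-- steps to a symbol node n, reads its letter a and continues from cont n.
-- In both cases the reached location is final, hence lies in evolve S for
-- any S ∋ q; in the second case cont n lies in stepSet a (evolve S).  So
-- each letter is simulated by one evolve step and one symbol step, and the
-- end of the input by a final evolve step, by induction on the PWπ run.
--
-- Along a lockstep run from ({p} , w) the
-- invariant "every q ∈ S is PWπ-reachable from (p , w) with the current
-- remaining input" is preserved, so null ∈ S on empty input yields an
-- accepting PWπ run.

open import Defs
open import Data.List using (List; []; _∷_)
open import Data.Product using (∃; _×_; _,_)
open import Data.Maybe using (just)
open import Data.Sum using (inj₁; inj₂)
open import Function.Bundles using (_⇔_; mk⇔; Equivalence)
open import Function.Properties.Equivalence using () renaming (refl to ⇔-refl)
open import Relation.Binary.PropositionalEquality using (_≡_; refl)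
open import Relation.Binary.Construct.Closure.ReflexiveTransitive
  using (ε; _◅_; _◅◅_)

module Equivalence-of-Machines {A : Set} (π : Heap A) (cont : Cont) where
  open Machines π cont

  ≐-refl : ∀ {S} → S ≐ S
  ≐-refl _ = ⇔-refl

  lift-⟶* : ∀ {q q'} w → q ⟶* q' → (q , w) ↦* (q' , w)
  lift-⟶* w ε        = ε
  lift-⟶* w (s ◅ ss) = pw-eps s ◅ lift-⟶* w ss

  data AcceptingShape (q : Loc) (w : List A) : Set where
    ends-at-null : q ⟶* null → w ≡ [] → AcceptingShape q w
    reads-symbol : ∀ {a n w'} → q ⟶* ptr n → π n ≡ just (sym a) →
                   w ≡ a ∷ w' → (cont n , w') ↦* (null , []) →
                   AcceptingShape q w

  accepting-shape : ∀ {q w} → (q , w) ↦* (null , []) → AcceptingShape q w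
  accepting-shape ε                         = ends-at-null ε refl
  accepting-shape (pw-sym (sym₁ h) ◅ run)   = reads-symbol ε h refl run
  accepting-shape (pw-eps s ◅ run) with accepting-shape run
  ... | ends-at-null path w≡[]        = ends-at-null (s ◅ path) w≡[]
  ... | reads-symbol path h w≡aw' rest = reads-symbol (s ◅ path) h w≡aw' rest

  completeness : ∀ w {S q} → S q → (q , w) ↦* (null , []) →
                 ∃ λ S' → (S , w) ⇒* (S' , []) × S' null
  completeness w {S} {q} q∈S run with accepting-shape run
  ... | ends-at-null path refl =
    evolve S , ls-evo ≐-refl ◅ ε , (q , q∈S , path , inj₁ refl)
  ... | reads-symbol {a} {n} {w'} path h refl rest
    with completeness w' {stepSet a (evolve S)} next∈S' rest
    where
      n∈evolve : evolve S (ptr n)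
      n∈evolve = q , q∈S , path , inj₂ (a , n , refl , h)
      next∈S' : stepSet a (evolve S) (cont n)
      next∈S' = ptr n , n∈evolve , sym₁ h
  ... | S' , lockstep , null∈S' =
    S' , ls-evo ≐-refl ◅ ls-sym ≐-refl ◅ lockstep , null∈S'

  ReachableFrom : PWConf → LConf → Set
  ReachableFrom c₀ (S , w) = ∀ q → S q → c₀ ↦* (q , w)

  -- One lockstep transition preserves the invariant: a symbol step extends
  -- a PWπ run by the same labelled step, an evolve step by the unlabelled
  -- path witnessing membership in evolve S.
  reachable-step : ∀ {c₀ c c'} → c ⇒ c' → ReachableFrom c₀ c → ReachableFrom c₀ c'
  reachable-step (ls-sym S'≐step) reach q q∈S' with Equivalence.to (S'≐step q) q∈S'
  ... | p' , p'∈S , st = reach p' p'∈S ◅◅ (pw-sym st ◅ ε)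
  reachable-step (ls-evo {w = w} S'≐evo) reach q q∈S' with Equivalence.to (S'≐evo q) q∈S'
  ... | p' , p'∈S , path , _ = reach p' p'∈S ◅◅ lift-⟶* w path

  reachable-steps : ∀ {c₀ c c'} → c ⇒* c' → ReachableFrom c₀ c → ReachableFrom c₀ c'
  reachable-steps ε              reach = reach
  reachable-steps (step ◅ steps) reach = reachable-steps steps (reachable-step step reach)

  soundness : ∀ {q w S} → (｛ q ｝ , w) ⇒* (S , []) → S null → (q , w) ↦* (null , [])
  soundness lockstep null∈S = reachable-steps lockstep start null null∈S
    where
      start : ∀ {q w} → ReachableFrom (q , w) (｛ q ｝ , w)
      start _ refl = ε

theorem3 : (A : Set) → Finite A →
    (e : Regex A) (π : Heap A) (p : Addr) → π , p ⊨ e →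
    (cont : Cont) → ContOK π p cont →
    (w : List A) →
    Machines._↦*_ π cont (ptr p , w) (null , [])
    ⇔ (∃ λ S → Machines._⇒*_ π cont (Machines.｛_｝ π cont (ptr p) , w) (S , []) × S null)
theorem3 A _ e π p _ cont _ w = mk⇔
  (completeness w refl)
  (λ { (S , lockstep , null∈S) → soundness lockstep null∈S })
  where open Equivalence-of-Machines π cont
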